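{- Let $V$ be a set with $|V| = n \ge 4$ and let $A \subset V$ with $|A| = 3$. Let $G_1, G_2, G_3$ be graphs on vertex set $V$ such that no edge of $G_1$ is disjoint from an edge of $G_2$ or from an edge of $G_3$. Then $\sum_{i=1}^3 \sum_{v \in A} \deg_{G_i}(v) \le 6(n-1)$.
   Context: $\deg_{G}(v)$ denotes the degree of vertex $v$ in the (simple) graph $G$. -}

module Defs where

open import Data.Nat using (ℕ)
open import Data.Fin using (Fin)
open import Data.Fin.Subset using (Subset; _∈_)
open import Data.Fin.Subset.Properties using (_∈?_)
open import Data.List using (List; length; filter; allFin; map)
open import Data.Nat.ListAction using (sum)
open import Data.Product using (_×_)
open import Relation.Nullary using (¬_)
open import Relation.Binary.PropositionalEquality using (_≡_)
open import Relation.Binary using (Decidable)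

record SimpleGraph (n : ℕ) : Set₁ where
  field
    Adj     : Fin n → Fin n → Set
    adj?    : Decidable Adj
    symm    : ∀ {u v} → Adj u v → Adj v u
    irrefl  : ∀ {v} → ¬ Adj v v

open SimpleGraph public

deg : ∀ {n} → SimpleGraph n → Fin n → ℕ
deg G v = length (filter (adj? G v) (allFin _))

sumOver : ∀ {n} → Subset n → (Fin n → ℕ) → ℕ
sumOver {n} A f = sum (map f (filter (_∈? A) (allFin n)))

PairsDisjoint : ∀ {n} → Fin n → Fin n → Fin n → Fin n → Set
PairsDisjoint x y u w = ¬ (x ≡ u) × ¬ (x ≡ w) × ¬ (y ≡ u) × ¬ (y ≡ w)

CrossIntersecting : ∀ {n} → SimpleGraph n → SimpleGraph n → Set
CrossIntersecting G H =
  ∀ x y u w → Adj G x y → Adj H u w → ¬ PairsDisjoint x y u w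

module Submission where

-- For a vertex v let mult v u ∈ {0,1,2,3} be the number of
-- graphs G₁, G₂, G₃ containing the edge vu, and load v = Σ_u mult v u, the
-- sum of the three degrees of v.  Two local facts about disjoint pairs
-- e, f drive everything: 2·mult e + mult f ≤ 6, hence mult e + mult f ≤ 4;
-- and if some edge xw lies in all three graphs, every edge of every G_i
-- meets {x, w}.
--   * No vertex of A lies on such a "triple edge": every load is ≤ 2(n-1).
--   * A triple edge xw with x ∈ A, w ∉ A: the other two vertices of A only
--     see x and w, and the pair bound caps their loads by 8 in total.
--   * A triple edge xb inside A: the last vertex c only sees x and b; a
--     fourth vertex d absorbs the excess via 2·mult xc + mult bd ≤ 6 and
--     2·mult bc + mult xd ≤ 6.
-- Sums over vertices are handled by one counting lemma: a function bounded
-- by j outside a list P of distinct points sums to at most Σ_{p∈P} f p plus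
-- j for each remaining point.

open import Defs
open import Data.Nat using (ℕ; zero; suc; _+_; _*_; _∸_; _≤_; _<_; z≤n; s≤s)
open import Data.Nat.Properties
open import Data.Nat.Tactic.RingSolver using (solve-∀)
open import Data.Nat.ListAction using (sum)
open import Data.Fin using (Fin; zero; suc)
open import Data.Fin.Properties using (any?) renaming (_≟_ to _≟ᶠ_)
open import Data.Fin.Subset using (Subset; ∣_∣; inside; outside)
open import Data.Fin.Subset.Properties using (_∈?_)
import Data.Vec as Vec
open import Data.Vec.Functional using (updateAt)
open import Data.Vec.Functional.Properties using (updateAt-updates; updateAt-minimal)
open import Data.List using (List; []; _∷_; length; filter; allFin; map; tabulate)
open import Data.List.Properties using (map-tabulate; map-cong-local)
open import Data.List.Membership.Propositional using (_∈_; _∉_)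
open import Data.List.Relation.Unary.Any using (here; there)
import Data.List.Relation.Unary.Any as Any
import Data.List.Relation.Unary.All as All
open import Data.List.Relation.Unary.AllPairs using ([]; _∷_)
open import Data.List.Relation.Unary.Unique.Propositional using (Unique)
open import Data.List.Relation.Unary.Unique.Propositional.Properties using (filter⁺; allFin⁺)
open import Data.Bool using (true; false; if_then_else_)
open import Data.Product using (∃-syntax; _×_; _,_)
open import Data.Empty using (⊥-elim)
open import Relation.Nullary using (¬_; Dec; yes; no; does; ¬?)
open import Relation.Nullary.Decidable using (dec-true; dec-false; decidable-stable; _×-dec_)
open import Relation.Binary.PropositionalEquality
open import Algebra.Properties.CommutativeMonoid.Sum +-0-commutativeMonoid
  using (∑-distrib-+; sum-syntax) renaming (sum to ∑)

open ≤-Reasoning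

∑-mono : ∀ {n} {f g : Fin n → ℕ} → (∀ u → f u ≤ g u) → ∑ f ≤ ∑ g
∑-mono {zero}  f≤g = z≤n
∑-mono {suc n} f≤g = +-mono-≤ (f≤g zero) (∑-mono (λ u → f≤g (suc u)))

∑-const : ∀ n j → ∑[ u < n ] j ≡ n * j
∑-const zero    j = refl
∑-const (suc n) j = cong (j +_) (∑-const n j)

∑-updateAt : ∀ {n} (f : Fin n → ℕ) (p : Fin n) (a : ℕ)
  → ∑ f + a ≡ ∑ (updateAt f p (λ _ → a)) + f p
∑-updateAt {suc n} f zero a = swap (f zero) (∑[ u < n ] f (suc u)) a
  where
    swap : ∀ x s a → x + s + a ≡ a + s + x
    swap = solve-∀
∑-updateAt {suc n} f (suc p) a = begin-equality
  f zero + ∑ f′ + a                          ≡⟨ +-assoc (f zero) _ a ⟩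
  f zero + (∑ f′ + a)                        ≡⟨ cong (f zero +_) (∑-updateAt f′ p a) ⟩
  f zero + (∑ (updateAt f′ p _) + f′ p)      ≡⟨ +-assoc (f zero) _ (f′ p) ⟨
  f zero + ∑ (updateAt f′ p (λ _ → a)) + f′ p ∎
  where
    f′ : Fin n → ℕ
    f′ u = f (suc u)

-- The counting lemma: if f ≤ j off a duplicate-free list P of points, then
-- Σ f ≤ Σ_{p ∈ P} f p + (n - |P|)·j, stated without truncated subtraction.
-- Proof: induct on P, raising the value at the head point to j.
∑-bounded-off : ∀ {n} (f : Fin n → ℕ) (j : ℕ) (P : List (Fin n)) → Unique P
  → (∀ u → u ∉ P → f u ≤ j)
  → ∑ f + length P * j ≤ sum (map f P) + n * j
∑-bounded-off {n} f j [] _ f≤j = begin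
  ∑ f + 0          ≡⟨ +-identityʳ (∑ f) ⟩
  ∑ f              ≤⟨ ∑-mono (λ u → f≤j u λ ()) ⟩
  ∑[ u < n ] j     ≡⟨ ∑-const n j ⟩
  n * j            ∎
∑-bounded-off {n} f j (p ∷ P) (p∉P ∷ uniqueP) f≤j = begin
  ∑ f + (j + length P * j)         ≡⟨ +-assoc (∑ f) j _ ⟨
  ∑ f + j + length P * j           ≡⟨ cong (_+ length P * j) (∑-updateAt f p j) ⟩
  ∑ g + f p + length P * j         ≡⟨ bring-forward (∑ g) (f p) _ ⟩
  f p + (∑ g + length P * j)       ≤⟨ +-monoʳ-≤ (f p) (∑-bounded-off g j P uniqueP g≤j) ⟩
  f p + (sum (map g P) + n * j)    ≡⟨ cong (λ L → f p + (sum L + n * j)) g≡f-on-P ⟩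
  f p + (sum (map f P) + n * j)    ≡⟨ +-assoc (f p) _ (n * j) ⟨
  f p + sum (map f P) + n * j      ∎
  where
    g : Fin n → ℕ
    g = updateAt f p (λ _ → j)
    bring-forward : ∀ x y z → x + y + z ≡ y + (x + z)
    bring-forward = solve-∀
    g≡f-on-P : map g P ≡ map f P
    g≡f-on-P = map-cong-local (All.map (λ p≢u → updateAt-minimal _ p f (≢-sym p≢u)) p∉P)
    g≤j : ∀ u → u ∉ P → g u ≤ j
    g≤j u u∉P with u ≟ᶠ p
    ... | yes refl = ≤-reflexive (updateAt-updates p f)
    ... | no u≢p   = ≤-trans (≤-reflexive (updateAt-minimal u p f u≢p))
                       (f≤j u λ { (here u≡p) → u≢p u≡p ; (there u∈P) → u∉P u∈P })

fresh : ∀ {n} (P : List (Fin n)) → Unique P → length P < n → ∃[ u ] u ∉ P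
fresh {n} P uniqueP |P|<n with any? (λ u → ¬? (Any.any? (u ≟ᶠ_) P))
... | yes missed = missed
... | no none    = ⊥-elim (<⇒≱ |P|<n n≤|P|)
  where
    covered : ∀ u → u ∈ P
    covered u = decidable-stable (Any.any? (u ≟ᶠ_) P) (λ u∉P → none (u , u∉P))
    ones : ∀ (Q : List (Fin n)) → sum (map (λ _ → 1) Q) ≡ length Q
    ones []      = refl
    ones (_ ∷ Q) = cong suc (ones Q)
    n≤|P| : n ≤ length P
    n≤|P| = begin
      n                                   ≡⟨ trans (∑-const n 1) (*-identityʳ n) ⟨
      ∑[ u < n ] 1                        ≡⟨ +-identityʳ _ ⟨
      ∑[ u < n ] 1 + 0                    ≡⟨ cong (∑[ u < n ] 1 +_) (*-zeroʳ (length P)) ⟨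
      ∑[ u < n ] 1 + length P * 0         ≤⟨ ∑-bounded-off (λ _ → 1) 0 P uniqueP
                                               (λ u u∉P → ⊥-elim (u∉P (covered u))) ⟩
      sum (map (λ _ → 1) P) + n * 0       ≡⟨ cong₂ _+_ (ones P) (*-zeroʳ n) ⟩
      length P + 0                        ≡⟨ +-identityʳ _ ⟩
      length P                            ∎

⟦_⟧ : ∀ {P : Set} → Dec P → ℕ
⟦ d ⟧ = if does d then 1 else 0

⟦⟧-yes : ∀ {P : Set} (d : Dec P) → P → ⟦ d ⟧ ≡ 1
⟦⟧-yes d p = cong (λ b → if b then 1 else 0) (dec-true d p)

⟦⟧-no : ∀ {P : Set} (d : Dec P) → ¬ P → ⟦ d ⟧ ≡ 0
⟦⟧-no d ¬p = cong (λ b → if b then 1 else 0) (dec-false d ¬p)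

⟦⟧≤1 : ∀ {P : Set} (d : Dec P) → ⟦ d ⟧ ≤ 1
⟦⟧≤1 (yes _) = s≤s z≤n
⟦⟧≤1 (no _)  = z≤n

⟦⟧-⇔ : ∀ {P Q : Set} → (P → Q) → (Q → P) → (p : Dec P) (q : Dec Q) → ⟦ p ⟧ ≡ ⟦ q ⟧
⟦⟧-⇔ P→Q Q→P (yes p) q = sym (⟦⟧-yes q (P→Q p))
⟦⟧-⇔ P→Q Q→P (no ¬p) q = sym (⟦⟧-no q (λ x → ¬p (Q→P x)))

⟦⟧-two-of-three : ∀ {P Q R : Set} (p : Dec P) (q : Dec Q) (r : Dec R)
  → ¬ (P × Q × R) → ⟦ p ⟧ + (⟦ q ⟧ + ⟦ r ⟧) ≤ 2
⟦⟧-two-of-three (yes x) (yes y) (yes z) ¬all = ⊥-elim (¬all (x , y , z))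
⟦⟧-two-of-three (yes _) (yes _) (no _)  _    = ≤-refl
⟦⟧-two-of-three (yes _) (no _)  r       _    = s≤s (⟦⟧≤1 r)
⟦⟧-two-of-three (no _)  q       r       _    = +-mono-≤ (⟦⟧≤1 q) (⟦⟧≤1 r)

-- The arithmetic core of the cross-intersection bound: p, q are the
-- G₁-indicators and s, t the G₂+G₃ counts of two disjoint pairs, and a
-- G₁-edge on either pair kills the G₂/G₃-edges on the other.
weighted-bound : ∀ {P Q : Set} (p : Dec P) (q : Dec Q) {s t : ℕ} → s ≤ 2 → t ≤ 2
  → (P → t ≡ 0) → (Q → s ≡ 0) → 2 * (⟦ p ⟧ + s) + (⟦ q ⟧ + t) ≤ 6
weighted-bound (yes x) (yes y) s≤2 t≤2 kill-t kill-s
  rewrite kill-t x | kill-s y = m≤m+n 3 3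
weighted-bound (yes x) (no _)  s≤2 t≤2 kill-t kill-s
  rewrite kill-t x = +-mono-≤ (*-monoʳ-≤ 2 (s≤s s≤2)) z≤n
weighted-bound (no _)  (yes y) s≤2 t≤2 kill-t kill-s
  rewrite kill-s y = s≤s (≤-trans t≤2 (m≤m+n 2 3))
weighted-bound (no _)  (no _)  s≤2 t≤2 kill-t kill-s =
  +-mono-≤ (*-monoʳ-≤ 2 s≤2) t≤2

balanced-sum : ∀ a b → 2 * a + b ≤ 6 → 2 * b + a ≤ 6 → a + b ≤ 4
balanced-sum a b ab ba = *-cancelˡ-≤ 3 (begin
  3 * (a + b)               ≡⟨ split a b ⟩
  (2 * a + b) + (2 * b + a) ≤⟨ +-mono-≤ ab ba ⟩
  12                        ∎)
  where
    split : ∀ a b → 3 * (a + b) ≡ (2 * a + b) + (2 * b + a)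
    split = solve-∀

-- The arithmetic of the case of a triple edge xb inside A = {x, b, c}:
-- S = load x + load b is bounded through the points x, b, c, d (where
-- px, pb, A + B, C + D are the values there), lc = load c ≤ A + B, and the
-- weighted bounds at the disjoint pairs (xc, bd) and (bc, xd) close the gap.
inner-triple-arithmetic : ∀ n S lc px pb A B C D
  → S + 24 ≤ px + (pb + ((A + B) + ((C + D) + 0))) + n * 6
  → px ≤ 3 → pb ≤ 3 → lc ≤ A + B → 2 * A + D ≤ 6 → 2 * B + C ≤ 6
  → S + lc + 6 ≤ 6 * n
inner-triple-arithmetic n S lc px pb A B C D S≤ px≤3 pb≤3 lc≤ wA wB = +-cancelˡ-≤ 24 _ _ (begin
  24 + (S + lc + 6)                                        ≤⟨ +-monoʳ-≤ 24 (+-monoˡ-≤ 6 (+-monoʳ-≤ S lc≤)) ⟩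
  24 + (S + (A + B) + 6)                                   ≡⟨ split S (A + B) ⟩
  (S + 24) + (A + B + 6)                                   ≤⟨ +-monoˡ-≤ (A + B + 6) S≤ ⟩
  px + (pb + ((A + B) + ((C + D) + 0))) + n * 6 + (A + B + 6)
                                                           ≤⟨ +-monoˡ-≤ (A + B + 6) (+-monoˡ-≤ (n * 6)
                                                                (+-mono-≤ px≤3 (+-monoˡ-≤ _ pb≤3))) ⟩
  3 + (3 + ((A + B) + ((C + D) + 0))) + n * 6 + (A + B + 6) ≡⟨ collect n A B C D ⟩
  12 + ((2 * A + D) + (2 * B + C)) + 6 * n                 ≤⟨ +-monoˡ-≤ (6 * n) (+-monoʳ-≤ 12 (+-mono-≤ wA wB)) ⟩
  24 + 6 * n                                               ∎)
  where
    split : ∀ S P → 24 + (S + P + 6) ≡ (S + 24) + (P + 6)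
    split = solve-∀
    collect : ∀ n A B C D → 3 + (3 + ((A + B) + ((C + D) + 0))) + n * 6 + (A + B + 6)
                            ≡ 12 + ((2 * A + D) + (2 * B + C)) + 6 * n
    collect = solve-∀

swap₁₂ : ∀ p q r → p + q + r + 6 ≡ q + p + r + 6
swap₁₂ = solve-∀

swap₂₃ : ∀ p q r → p + q + r + 6 ≡ p + r + q + 6
swap₂₃ = solve-∀

rotate : ∀ p q r → p + q + r + 6 ≡ q + r + p + 6
rotate = solve-∀

sum-allFin : ∀ {n} (f : Fin n → ℕ) → sum (map f (allFin n)) ≡ ∑ f
sum-allFin {n} f = trans (cong sum (map-tabulate (λ u → u) f)) (sum-tabulate f)
  where
    sum-tabulate : ∀ {m} (g : Fin m → ℕ) → sum (tabulate g) ≡ ∑ g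
    sum-tabulate {zero}  g = refl
    sum-tabulate {suc m} g = cong (g zero +_) (sum-tabulate (λ u → g (suc u)))

length-filter : ∀ {A : Set} {P : A → Set} (P? : ∀ x → Dec (P x)) (xs : List A)
  → length (filter P? xs) ≡ sum (map (λ x → ⟦ P? x ⟧) xs)
length-filter P? []       = refl
length-filter P? (x ∷ xs) with does (P? x)
... | true  = cong suc (length-filter P? xs)
... | false = length-filter P? xs

deg-∑ : ∀ {n} (G : SimpleGraph n) (v : Fin n) → deg G v ≡ ∑[ u < n ] ⟦ adj? G v u ⟧
deg-∑ {n} G v = trans (length-filter (adj? G v) (allFin n)) (sum-allFin (λ u → ⟦ adj? G v u ⟧))

∣∣-∑ : ∀ {n} (A : Subset n) → ∑[ u < n ] ⟦ u ∈? A ⟧ ≡ ∣ A ∣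
∣∣-∑ Vec.[]            = refl
∣∣-∑ (inside Vec.∷ A)  = cong suc (∣∣-∑ A)
∣∣-∑ (outside Vec.∷ A) = ∣∣-∑ A

three-members : ∀ {n} (A : Subset n) → ∣ A ∣ ≡ 3
  → ∃[ a ] ∃[ b ] ∃[ c ] (a ≢ b × a ≢ c × b ≢ c × filter (_∈? A) (allFin n) ≡ a ∷ b ∷ c ∷ [])
three-members {n} A ∣A∣≡3 =
  listed (filter (_∈? A) (allFin n)) length≡3 (filter⁺ (_∈? A) (allFin⁺ n))
  where
    length≡3 : length (filter (_∈? A) (allFin n)) ≡ 3
    length≡3 = trans (length-filter (_∈? A) (allFin n)) (trans (sum-allFin (λ u → ⟦ u ∈? A ⟧)) (trans (∣∣-∑ A) ∣A∣≡3))
    listed : ∀ (L : List (Fin n)) → length L ≡ 3 → Unique L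
      → ∃[ a ] ∃[ b ] ∃[ c ] (a ≢ b × a ≢ c × b ≢ c × L ≡ a ∷ b ∷ c ∷ [])
    listed (a ∷ b ∷ c ∷ []) refl ((a≢b All.∷ a≢c All.∷ All.[]) ∷ (b≢c All.∷ All.[]) ∷ All.[] ∷ []) =
      a , b , c , a≢b , a≢c , b≢c , refl

sumOver-three : ∀ {n} (A : Subset n) {a b c : Fin n} (f : Fin n → ℕ)
  → filter (_∈? A) (allFin n) ≡ a ∷ b ∷ c ∷ [] → sumOver A f ≡ f a + f b + f c
sumOver-three A {a} {b} {c} f members≡ = begin-equality
  sum (map f (filter (_∈? A) (allFin _)))  ≡⟨ cong (λ L → sum (map f L)) members≡ ⟩
  f a + (f b + (f c + 0))                   ≡⟨ cong (λ z → f a + (f b + z)) (+-identityʳ (f c)) ⟩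
  f a + (f b + f c)                         ≡⟨ +-assoc (f a) (f b) (f c) ⟨
  f a + f b + f c                           ∎

flip-disjoint : ∀ {n} {x y u w : Fin n} → PairsDisjoint x y u w → PairsDisjoint u w x y
flip-disjoint (x≢u , x≢w , y≢u , y≢w) = ≢-sym x≢u , ≢-sym y≢u , ≢-sym x≢w , ≢-sym y≢w

module ThreeGraphs {n : ℕ} (G₁ G₂ G₃ : SimpleGraph n)
                   (G₁⋈G₂ : CrossIntersecting G₁ G₂) (G₁⋈G₃ : CrossIntersecting G₁ G₃) where

  mult₂₃ : Fin n → Fin n → ℕ
  mult₂₃ v u = ⟦ adj? G₂ v u ⟧ + ⟦ adj? G₃ v u ⟧

  mult : Fin n → Fin n → ℕ
  mult v u = ⟦ adj? G₁ v u ⟧ + mult₂₃ v u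

  load : Fin n → ℕ
  load v = ∑[ u < n ] mult v u

  load-deg : ∀ v → load v ≡ deg G₁ v + (deg G₂ v + deg G₃ v)
  load-deg v = begin-equality
    ∑[ u < n ] (⟦ adj? G₁ v u ⟧ + mult₂₃ v u)     ≡⟨ ∑-distrib-+ (λ u → ⟦ adj? G₁ v u ⟧) (mult₂₃ v) ⟩
    ∑[ u < n ] ⟦ adj? G₁ v u ⟧ + ∑[ u < n ] mult₂₃ v u
                                                   ≡⟨ cong (∑[ u < n ] ⟦ adj? G₁ v u ⟧ +_) (∑-distrib-+ (λ u → ⟦ adj? G₂ v u ⟧) (λ u → ⟦ adj? G₃ v u ⟧)) ⟩
    ∑[ u < n ] ⟦ adj? G₁ v u ⟧ + (∑[ u < n ] ⟦ adj? G₂ v u ⟧ + ∑[ u < n ] ⟦ adj? G₃ v u ⟧)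
                                                   ≡⟨ sym (cong₂ _+_ (deg-∑ G₁ v) (cong₂ _+_ (deg-∑ G₂ v) (deg-∑ G₃ v))) ⟩
    deg G₁ v + (deg G₂ v + deg G₃ v)               ∎

  Triple : Fin n → Fin n → Set
  Triple v u = Adj G₁ v u × Adj G₂ v u × Adj G₃ v u

  triple? : ∀ v u → Dec (Triple v u)
  triple? v u = adj? G₁ v u ×-dec adj? G₂ v u ×-dec adj? G₃ v u

  mult₂₃≤2 : ∀ v u → mult₂₃ v u ≤ 2
  mult₂₃≤2 v u = +-mono-≤ (⟦⟧≤1 (adj? G₂ v u)) (⟦⟧≤1 (adj? G₃ v u))

  mult≤3 : ∀ v u → mult v u ≤ 3
  mult≤3 v u = +-mono-≤ (⟦⟧≤1 (adj? G₁ v u)) (mult₂₃≤2 v u)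

  mult≤2 : ∀ v u → ¬ Triple v u → mult v u ≤ 2
  mult≤2 v u = ⟦⟧-two-of-three (adj? G₁ v u) (adj? G₂ v u) (adj? G₃ v u)

  triple-distinct : ∀ {v u} → Triple v u → v ≢ u
  triple-distinct (e₁ , _) refl = irrefl G₁ e₁

  mult-irrefl : ∀ v → mult v v ≡ 0
  mult-irrefl v = cong₂ _+_ (⟦⟧-no (adj? G₁ v v) (irrefl G₁))
    (cong₂ _+_ (⟦⟧-no (adj? G₂ v v) (irrefl G₂)) (⟦⟧-no (adj? G₃ v v) (irrefl G₃)))

  mult-sym : ∀ v u → mult v u ≡ mult u v
  mult-sym v u = cong₂ _+_ (sym-⟦⟧ G₁) (cong₂ _+_ (sym-⟦⟧ G₂) (sym-⟦⟧ G₃))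
    where
      sym-⟦⟧ : (G : SimpleGraph n) → ⟦ adj? G v u ⟧ ≡ ⟦ adj? G u v ⟧
      sym-⟦⟧ G = ⟦⟧-⇔ (symm G) (symm G) (adj? G v u) (adj? G u v)

  G₁-blocks : ∀ {v u s t} → PairsDisjoint v u s t → Adj G₁ v u → mult₂₃ s t ≡ 0
  G₁-blocks {v} {u} {s} {t} disjoint e₁ =
    cong₂ _+_ (⟦⟧-no (adj? G₂ s t) (λ e₂ → G₁⋈G₂ v u s t e₁ e₂ disjoint))
              (⟦⟧-no (adj? G₃ s t) (λ e₃ → G₁⋈G₃ v u s t e₁ e₃ disjoint))

  disjoint-weight : ∀ {v u s t} → PairsDisjoint v u s t → 2 * mult v u + mult s t ≤ 6
  disjoint-weight {v} {u} {s} {t} disjoint =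
    weighted-bound (adj? G₁ v u) (adj? G₁ s t) (mult₂₃≤2 v u) (mult₂₃≤2 s t)
      (G₁-blocks disjoint) (G₁-blocks (flip-disjoint disjoint))

  disjoint-pair : ∀ {v u s t} → PairsDisjoint v u s t → mult v u + mult s t ≤ 4
  disjoint-pair {v} {u} {s} {t} disjoint = balanced-sum (mult v u) (mult s t)
    (disjoint-weight disjoint) (disjoint-weight (flip-disjoint disjoint))

  off-triple : ∀ {x w v u} → Triple x w → PairsDisjoint v u x w → mult v u ≡ 0
  off-triple {x} {w} {v} {u} (e₁ , e₂ , _) disjoint =
    cong₂ _+_ (⟦⟧-no (adj? G₁ v u) (λ f₁ → G₁⋈G₂ v u x w f₁ e₂ disjoint))
              (G₁-blocks (flip-disjoint disjoint) e₁)

  load-bound : ∀ v j → (∀ u → mult v u ≤ j) → load v + j ≤ n * j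
  load-bound v j mult≤j = begin
    load v + j                        ≡⟨ cong (load v +_) (+-identityʳ j) ⟨
    load v + (j + 0)                  ≤⟨ ∑-bounded-off (mult v) j (v ∷ []) (All.[] ∷ [])
                                           (λ u _ → mult≤j u) ⟩
    mult v v + 0 + n * j              ≡⟨ cong (λ z → z + 0 + n * j) (mult-irrefl v) ⟩
    n * j                             ∎

  star-bound : ∀ {x w v} → Triple x w → v ≢ x → v ≢ w → load v ≤ mult v x + mult v w
  star-bound {x} {w} {v} triple v≢x v≢w = begin
    load v                              ≡⟨ +-identityʳ (load v) ⟨
    load v + 2 * 0                      ≤⟨ ∑-bounded-off (mult v) 0 (x ∷ w ∷ []) unique off ⟩
    mult v x + (mult v w + 0) + n * 0   ≡⟨ cong₂ _+_ (cong (mult v x +_) (+-identityʳ _)) (*-zeroʳ n) ⟩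
    mult v x + mult v w + 0             ≡⟨ +-identityʳ _ ⟩
    mult v x + mult v w                 ∎
    where
      unique : Unique (x ∷ w ∷ [])
      unique = (triple-distinct triple All.∷ All.[]) ∷ All.[] ∷ []
      off : ∀ u → u ∉ x ∷ w ∷ [] → mult v u ≤ 0
      off u u∉ = ≤-reflexive (off-triple triple
        (v≢x , v≢w , (λ u≡x → u∉ (here u≡x)) , (λ u≡w → u∉ (there (here u≡w)))))

  -- Case 1: no vertex of A lies on a triple edge, so each load is ≤ 2(n-1).
  no-triple-case : ∀ {a b c} → (∀ u → ¬ Triple a u) → (∀ u → ¬ Triple b u) → (∀ u → ¬ Triple c u)
    → load a + load b + load c + 6 ≤ 6 * n
  no-triple-case {a} {b} {c} ¬a ¬b ¬c = begin
    load a + load b + load c + 6             ≡⟨ regroup (load a) (load b) (load c) ⟩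
    (load a + 2) + (load b + 2) + (load c + 2) ≤⟨ +-mono-≤ (+-mono-≤ (bound a ¬a) (bound b ¬b)) (bound c ¬c) ⟩
    n * 2 + n * 2 + n * 2                    ≡⟨ six n ⟩
    6 * n                                    ∎
    where
      bound : ∀ v → (∀ u → ¬ Triple v u) → load v + 2 ≤ n * 2
      bound v ¬v = load-bound v 2 (λ u → mult≤2 v u (¬v u))
      regroup : ∀ x y z → x + y + z + 6 ≡ (x + 2) + (y + 2) + (z + 2)
      regroup = solve-∀
      six : ∀ n → n * 2 + n * 2 + n * 2 ≡ 6 * n
      six = solve-∀

  -- The load of x is at most
  -- 3(n-1); b and c only see x and w, and the pair bounds at the disjoint
  -- pairs (bx, cw) and (bw, cx) limit their loads to 8, which fits as n ≥ 4.
  outer-triple-case : ∀ {x b c w} → 4 ≤ n → Triple x w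
    → x ≢ b → x ≢ c → b ≢ c → w ≢ b → w ≢ c
    → load x + load b + load c + 6 ≤ 6 * n
  outer-triple-case {x} {b} {c} {w} 4≤n triple x≢b x≢c b≢c w≢b w≢c =
    +-cancelˡ-≤ 3 _ _ (begin
      3 + (load x + load b + load c + 6)     ≡⟨ regroup (load x) (load b) (load c) ⟩
      (load x + 3) + (load b + load c) + 6   ≤⟨ +-monoˡ-≤ 6 (+-mono-≤ (load-bound x 3 (mult≤3 x))
                                                  (+-mono-≤ (star-bound triple (≢-sym x≢b) (≢-sym w≢b))
                                                            (star-bound triple (≢-sym x≢c) (≢-sym w≢c)))) ⟩
      n * 3 + ((mult b x + mult b w) + (mult c x + mult c w)) + 6
                                              ≡⟨ cong (λ z → n * 3 + z + 6) (pair-up (mult b x) (mult b w) _ _) ⟩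
      n * 3 + ((mult b x + mult c w) + (mult b w + mult c x)) + 6
                                              ≤⟨ +-monoˡ-≤ 6 (+-monoʳ-≤ (n * 3)
                                                   (+-mono-≤ (disjoint-pair (b≢c , ≢-sym w≢b , x≢c , x≢w))
                                                             (disjoint-pair (b≢c , ≢-sym x≢b , w≢c , ≢-sym x≢w)))) ⟩
      n * 3 + 8 + 6                           ≡⟨ +-assoc (n * 3) 8 6 ⟩
      n * 3 + (2 + 12)                        ≤⟨ +-monoʳ-≤ (n * 3) (+-monoʳ-≤ 2 (*-monoʳ-≤ 3 4≤n)) ⟩
      n * 3 + (2 + 3 * n)                     ≡⟨ collect n ⟩
      2 + 6 * n                               ≤⟨ n≤1+n _ ⟩
      3 + 6 * n                               ∎)
    where
      x≢w : x ≢ w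
      x≢w = triple-distinct triple
      regroup : ∀ p q r → 3 + (p + q + r + 6) ≡ (p + 3) + (q + r) + 6
      regroup = solve-∀
      pair-up : ∀ p q r s → (p + q) + (r + s) ≡ (p + s) + (q + r)
      pair-up = solve-∀
      collect : ∀ n → n * 3 + (2 + 3 * n) ≡ 2 + 6 * n
      collect = solve-∀

  -- Case 3: a triple edge xb inside A = {x, b, c}.  A fourth vertex d
  -- exists since n ≥ 4, and the two weighted bounds at the disjoint pairs
  -- (xc, bd) and (bc, xd) pay for the edges from c.
  inner-triple-case : ∀ {x b c} → 4 ≤ n → Triple x b → x ≢ b → x ≢ c → b ≢ c
    → load x + load b + load c + 6 ≤ 6 * n
  inner-triple-case {x} {b} {c} 4≤n triple x≢b x≢c b≢c
    with fresh (x ∷ b ∷ c ∷ []) ((x≢b All.∷ x≢c All.∷ All.[]) ∷ (b≢c All.∷ All.[]) ∷ All.[] ∷ []) 4≤n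
  ... | d , d∉ = inner-triple-arithmetic n (load x + load b) (load c)
        (mult x x + mult b x) (mult x b + mult b b) (mult x c) (mult b c) (mult x d) (mult b d)
        (subst (λ S → S + 24 ≤ sum (map pair-mult (x ∷ b ∷ c ∷ d ∷ [])) + n * 6) (∑-distrib-+ (mult x) (mult b))
          (∑-bounded-off pair-mult 6 (x ∷ b ∷ c ∷ d ∷ []) distinct
            (λ u _ → +-mono-≤ (mult≤3 x u) (mult≤3 b u))))
        (+-mono-≤ (≤-reflexive (mult-irrefl x)) (mult≤3 b x))
        (+-mono-≤ (mult≤3 x b) (≤-reflexive (mult-irrefl b)))
        (subst (load c ≤_) (cong₂ _+_ (mult-sym c x) (mult-sym c b))
          (star-bound triple (≢-sym x≢c) (≢-sym b≢c)))
        (disjoint-weight (x≢b , ≢-sym d≢x , ≢-sym b≢c , ≢-sym d≢c))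
        (disjoint-weight (≢-sym x≢b , ≢-sym d≢b , ≢-sym x≢c , ≢-sym d≢c))
    where
      pair-mult : Fin n → ℕ
      pair-mult u = mult x u + mult b u
      d≢x : d ≢ x
      d≢x d≡x = d∉ (here d≡x)
      d≢b : d ≢ b
      d≢b d≡b = d∉ (there (here d≡b))
      d≢c : d ≢ c
      d≢c d≡c = d∉ (there (there (here d≡c)))
      distinct : Unique (x ∷ b ∷ c ∷ d ∷ [])
      distinct = (x≢b All.∷ x≢c All.∷ ≢-sym d≢x All.∷ All.[])
               ∷ (b≢c All.∷ ≢-sym d≢b All.∷ All.[])
               ∷ (≢-sym d≢c All.∷ All.[])
               ∷ All.[] ∷ []

  triple-case : ∀ {x b c w} → 4 ≤ n → Triple x w → x ≢ b → x ≢ c → b ≢ c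
    → load x + load b + load c + 6 ≤ 6 * n
  triple-case {x} {b} {c} {w} 4≤n triple x≢b x≢c b≢c with w ≟ᶠ b | w ≟ᶠ c
  ... | yes refl | _        = inner-triple-case 4≤n triple x≢b x≢c b≢c
  ... | no w≢b   | yes refl = subst (_≤ 6 * n) (swap₂₃ (load x) (load c) (load b))
                                (inner-triple-case 4≤n triple x≢c x≢b (≢-sym b≢c))
  ... | no w≢b   | no w≢c   = outer-triple-case 4≤n triple x≢b x≢c b≢c w≢b w≢c

  loads-bound : ∀ {a b c} → 4 ≤ n → a ≢ b → a ≢ c → b ≢ c
    → load a + load b + load c + 6 ≤ 6 * n
  loads-bound {a} {b} {c} 4≤n a≢b a≢c b≢c
    with any? (triple? a) | any? (triple? b) | any? (triple? c)
  ... | yes (_ , t) | _ | _ = triple-case 4≤n t a≢b a≢c b≢c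
  ... | no _ | yes (_ , t) | _ = subst (_≤ 6 * n) (swap₁₂ (load b) (load a) (load c))
                                   (triple-case 4≤n t (≢-sym a≢b) b≢c a≢c)
  ... | no _ | no _ | yes (_ , t) = subst (_≤ 6 * n) (rotate (load c) (load a) (load b))
                                      (triple-case 4≤n t (≢-sym a≢c) (≢-sym b≢c) a≢b)
  ... | no ¬a | no ¬b | no ¬c =
    no-triple-case (λ u t → ¬a (u , t)) (λ u t → ¬b (u , t)) (λ u t → ¬c (u , t))

  degree-sums : ∀ (A : Subset n) {a b c} → filter (_∈? A) (allFin n) ≡ a ∷ b ∷ c ∷ []
    → sumOver A (deg G₁) + sumOver A (deg G₂) + sumOver A (deg G₃) ≡ load a + load b + load c
  degree-sums A {a} {b} {c} members≡ = begin-equality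
    sumOver A (deg G₁) + sumOver A (deg G₂) + sumOver A (deg G₃)
      ≡⟨ cong₂ _+_ (cong₂ _+_ (over (deg G₁)) (over (deg G₂))) (over (deg G₃)) ⟩
    (deg G₁ a + deg G₁ b + deg G₁ c) + (deg G₂ a + deg G₂ b + deg G₂ c) + (deg G₃ a + deg G₃ b + deg G₃ c)
      ≡⟨ transpose (deg G₁ a) (deg G₁ b) (deg G₁ c) (deg G₂ a) (deg G₂ b) (deg G₂ c) (deg G₃ a) (deg G₃ b) (deg G₃ c) ⟩
    (deg G₁ a + (deg G₂ a + deg G₃ a)) + (deg G₁ b + (deg G₂ b + deg G₃ b)) + (deg G₁ c + (deg G₂ c + deg G₃ c))
      ≡⟨ cong₂ _+_ (cong₂ _+_ (load-deg a) (load-deg b)) (load-deg c) ⟨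
    load a + load b + load c
      ∎
    where
      over : ∀ f → sumOver A f ≡ f a + f b + f c
      over f = sumOver-three A f members≡
      transpose : ∀ a₁ b₁ c₁ a₂ b₂ c₂ a₃ b₃ c₃
        → (a₁ + b₁ + c₁) + (a₂ + b₂ + c₂) + (a₃ + b₃ + c₃)
          ≡ (a₁ + (a₂ + a₃)) + (b₁ + (b₂ + b₃)) + (c₁ + (c₂ + c₃))
      transpose = solve-∀

lemma2p3 : (n : ℕ) → 4 ≤ n → (A : Subset n) → ∣ A ∣ ≡ 3
    → (G₁ G₂ G₃ : SimpleGraph n)
    → CrossIntersecting G₁ G₂ → CrossIntersecting G₁ G₃
    → sumOver A (deg G₁) + sumOver A (deg G₂) + sumOver A (deg G₃) ≤ 6 * (n ∸ 1)
lemma2p3 (suc k) 4≤n A ∣A∣≡3 G₁ G₂ G₃ G₁⋈G₂ G₁⋈G₃ with three-members A ∣A∣≡3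
... | a , b , c , a≢b , a≢c , b≢c , members≡ = +-cancelʳ-≤ 6 _ _ (begin
  sumOver A (deg G₁) + sumOver A (deg G₂) + sumOver A (deg G₃) + 6
                                   ≡⟨ cong (_+ 6) (degree-sums A members≡) ⟩
  load a + load b + load c + 6     ≤⟨ loads-bound 4≤n a≢b a≢c b≢c ⟩
  6 * suc k                        ≡⟨ *-suc 6 k ⟩
  6 + 6 * k                        ≡⟨ +-comm 6 (6 * k) ⟩
  6 * k + 6                        ∎)
  where open ThreeGraphs G₁ G₂ G₃ G₁⋈G₂ G₁⋈G₃
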